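{- Let $G$ be a circular-arc graph with intersection model $F$. If $F$ contains at least four arcs $a(v)$ with density $d(v)\le 2$, then $G$ has no locally connected spanning tree.
   Context: A circular-arc graph $G$ is the intersection graph of a family $F$ of arcs on a circle: each vertex $v$ corresponds to an arc $a(v)\in F$, and two vertices are adjacent iff their arcs overlap. It is assumed that all arc endpoints are distinct and no arc covers the entire circle. The arc $a(v)$ begins at its head $h(v)$ and ends at its tail $t(v)$ in a counterclockwise traversal. The density $d(v)$ of $a(v)$ is the number of arcs of $F$ (including $a(v)$ itself) that contain the point $h(v)$. A locally connected spanning tree of $G$ is a spanning tree $T$ of $G$ such that for every vertex $v$, the set of neighbors of $v$ in $T$ induces a connected subgraph of $G$. -}

module Defs where

open import Data.Nat using (ℕ; _≤_; _<_; _≤?_; _<?_)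
open import Data.Fin using (Fin)
open import Data.Fin.Properties using (_≟_)
open import Data.List using (List; []; _∷_; length; filter; allFin; _∷ʳ_)
open import Data.List.Relation.Unary.Linked using (Linked)
open import Data.List.Relation.Unary.Unique.Propositional using (Unique)
open import Data.Product using (Σ; _×_; _,_)
open import Data.Sum using (_⊎_; inj₁; inj₂)
open import Relation.Nullary using (¬_; Dec)
open import Relation.Nullary.Decidable using (_×-dec_; _⊎-dec_)
open import Relation.Binary.PropositionalEquality using (_≡_)
open import Relation.Binary.Construct.Closure.ReflexiveTransitive using (Star)

-- The circle is represented combinatorially: endpoints are natural numbers,
-- read in increasing order as the counterclockwise order around the circle
-- (the circle "wraps" after all endpoints). Arc v starts at its head hd v and
-- runs counterclockwise to its tail tl v.
Endpoint : ℕ → Set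
Endpoint n = Fin n ⊎ Fin n

endpointOf : {n : ℕ} → (Fin n → ℕ) → (Fin n → ℕ) → Endpoint n → ℕ
endpointOf h t (inj₁ v) = h v
endpointOf h t (inj₂ v) = t v

record CAModel (n : ℕ) : Set where
  field
    hd : Fin n → ℕ
    tl : Fin n → ℕ
    distinct : ∀ i j → endpointOf hd tl i ≡ endpointOf hd tl j → i ≡ j

open CAModel public

InArcFrom : ℕ → ℕ → ℕ → Set
InArcFrom h t p = (h ≤ p × p ≤ t) ⊎ (t < h × (h ≤ p ⊎ p ≤ t))

inArcFrom? : ∀ h t p → Dec (InArcFrom h t p)
inArcFrom? h t p = ((h ≤? p) ×-dec (p ≤? t)) ⊎-dec ((t <? h) ×-dec ((h ≤? p) ⊎-dec (p ≤? t)))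

module _ {n : ℕ} (F : CAModel n) where

  InArc : ℕ → Fin n → Set
  InArc p v = InArcFrom (hd F v) (tl F v) p

  Adj : Fin n → Fin n → Set
  Adj u v = ¬ (u ≡ v) × Σ ℕ (λ p → InArc p u × InArc p v)

  density : Fin n → ℕ
  density v = length (filter (λ u → inArcFrom? (hd F u) (tl F u) (hd F v)) (allFin n))

  numLowDensity : ℕ
  numLowDensity = length (filter (λ v → density v ≤? 2) (allFin n))

InducedConnected : {n : ℕ} → (Fin n → Fin n → Set) → (Fin n → Set) → Set
InducedConnected E S =
  ∀ x y → S x → S y → Star (λ a b → E a b × S a × S b) x y

Connected : {n : ℕ} → (Fin n → Fin n → Set) → Set
Connected E = ∀ x y → Star E x y

HasCycle : {n : ℕ} → (Fin n → Fin n → Set) → Set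
HasCycle {n} E = Σ (Fin n) λ x → Σ (List (Fin n)) λ xs →
  2 ≤ length xs × Unique (x ∷ xs) × Linked E ((x ∷ xs) ∷ʳ x)

record IsSpanningTree {n : ℕ} (Adj : Fin n → Fin n → Set)
                      (T : Fin n → Fin n → Set) : Set where
  field
    sym       : ∀ u v → T u v → T v u
    subgraph  : ∀ u v → T u v → Adj u v
    connected : Connected T
    acyclic   : ¬ HasCycle T

record IsLocallyConnectedSpanningTree {n : ℕ} (Adj : Fin n → Fin n → Set)
                      (T : Fin n → Fin n → Set) : Set where
  field
    spanningTree : IsSpanningTree Adj T
    locallyConnected : ∀ v → InducedConnected Adj (λ u → T v u)

module Submission where

-- The head of an arc v of density at most 2 is covered by at most one arc other
-- than v. If G has a locally connected spanning tree, no independent set X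
-- separates G − X: a tree path can only pass X through some z ∈ X, and the tree
-- neighbours of z on both sides are joined within the neighbourhood of z, which
-- avoids X. The arcs covering h(vᵢ) or h(vⱼ) are those through two points just
-- before these heads, so they separate the arcs with heads in [h(vᵢ), h(vⱼ)) from
-- the others. Hence, for low-density v₁, v₂, v₃, v₄ with increasing heads, no arc
-- covers two of their heads; then the covers of h(v₁) and h(v₃) are pairwise
-- non-adjacent, lying on opposite sides of the points just before h(v₂) and
-- h(v₄), and they form an independent set separating v₁ or v₂ from v₃ or v₄.

open import Defs
open import Data.Nat using (ℕ; suc; _+_; _≤_; _<_; _≤?_; s≤s)
open import Data.Nat.Properties
  using (+-suc; +-mono-≤; +-mono-<; ≤-refl; ≤-trans; <-trans; <⇒≤; ≤-<-trans; <-≤-trans;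
         <-irrefl; <-asym; m≤n⇒m≤1+n; <⇒≱; ≰⇒>; ≮⇒≥; ≤∧≢⇒<; <-cmp; ≤-decTotalOrder)
open import Data.Fin using (Fin)
open import Data.Fin.Properties using (_≟_)
open import Function using (_∘′_)
open import Data.Product using (Σ; _×_; _,_; proj₁; proj₂; ∃-syntax)
open import Data.Sum using (_⊎_; inj₁; inj₂)
open import Data.Sum.Properties using (inj₁-injective)
open import Data.Empty using (⊥; ⊥-elim)
open import Data.List using (List; []; _∷_; length; filter; allFin; map)
open import Data.List.Properties using (length-map)
open import Data.List.Membership.Propositional using (_∈_)
open import Data.List.Membership.Propositional.Properties
  using (∈-filter⁺; ∈-filter⁻; ∈-allFin; ∈-map⁻; ∈-length)
open import Data.List.Relation.Unary.Any using (here; there)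
open import Data.List.Relation.Unary.All using (All; []; _∷_)
import Data.List.Relation.Unary.All as All
open import Data.List.Relation.Unary.AllPairs using (_∷_)
open import Data.List.Relation.Unary.Linked using (Linked; []; [-]; _∷_)
open import Data.List.Relation.Unary.Unique.Propositional using (Unique)
import Data.List.Relation.Unary.Unique.Propositional.Properties as Unique
open import Data.List.Relation.Binary.Permutation.Propositional using (↭-sym; ↭⇒↭ₛ)
open import Data.List.Relation.Binary.Permutation.Propositional.Properties
  using (∈-resp-↭; ↭-length)
open import Data.List.Relation.Binary.Permutation.Setoid.Properties using (Unique-resp-↭)
open import Data.List.Sort ≤-decTotalOrder using (sort; sort-↭; sort-↗)
open import Relation.Nullary using (¬_; Dec; yes; no)
open import Relation.Nullary.Decidable using (_×-dec_; _⊎-dec_; ¬?)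
open import Relation.Unary using (Decidable)
open import Relation.Binary.Definitions using (tri<; tri≈; tri>)
open import Relation.Binary.PropositionalEquality
  using (_≡_; _≢_; refl; sym; trans; cong; subst; ≢-sym; setoid)
open import Relation.Binary.Construct.Closure.ReflexiveTransitive using (Star; ε; _◅_)

private variable
  n a b m k h t p r : ℕ

even odd : ℕ → ℕ
even a = a + a
odd a = suc (a + a)

even-mono-< : a < b → even a < even b
even-mono-< a<b = +-mono-< a<b a<b

odd-mono-≤ : a ≤ b → odd a ≤ odd b
odd-mono-≤ a≤b = s≤s (+-mono-≤ a≤b a≤b)

odd-mono-< : a < b → odd a < odd b
odd-mono-< a<b = s≤s (even-mono-< a<b)

even<odd : a ≤ b → even a < odd b
even<odd = odd-mono-≤

odd<even : a < b → odd a < even b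
odd<even {a} {b} a<b = subst (_≤ even b) (cong suc (+-suc a a)) (+-mono-≤ a<b a<b)

odd-cancel-< : odd a < odd b → a < b
odd-cancel-< lt = ≰⇒> λ b≤a → <⇒≱ lt (odd-mono-≤ b≤a)

even≤odd⇒≤ : even a ≤ odd b → a ≤ b
even≤odd⇒≤ le = ≮⇒≥ λ b<a → <⇒≱ (odd<even b<a) le

odd≤even⇒< : odd a ≤ even b → a < b
odd≤even⇒< le = ≰⇒> λ b≤a → <⇒≱ (even<odd b≤a) le

InArcFrom-head : ∀ h t → InArcFrom h t h
InArcFrom-head h t with h ≤? t
... | yes h≤t = inj₁ (≤-refl , h≤t)
... | no h≰t = inj₂ (≰⇒> h≰t , inj₁ ≤-refl)

InArcFrom-odd : InArcFrom h t p → InArcFrom (odd h) (odd t) (odd p)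
InArcFrom-odd (inj₁ (h≤p , p≤t)) = inj₁ (odd-mono-≤ h≤p , odd-mono-≤ p≤t)
InArcFrom-odd (inj₂ (t<h , inj₁ h≤p)) = inj₂ (odd-mono-< t<h , inj₁ (odd-mono-≤ h≤p))
InArcFrom-odd (inj₂ (t<h , inj₂ p≤t)) = inj₂ (odd-mono-< t<h , inj₂ (odd-mono-≤ p≤t))

InArcFrom-below-head : InArcFrom h t p → p < h → t < h × p ≤ t
InArcFrom-below-head (inj₁ (h≤p , _)) p<h = ⊥-elim (<⇒≱ p<h h≤p)
InArcFrom-below-head (inj₂ (_ , inj₁ h≤p)) p<h = ⊥-elim (<⇒≱ p<h h≤p)
InArcFrom-below-head (inj₂ (t<h , inj₂ p≤t)) _ = t<h , p≤t

Between : ℕ → ℕ → ℕ → Set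
Between m k r = m < r × r < k

InArcFrom-between : ¬ InArcFrom h t m → ¬ InArcFrom h t k → Between m k p →
                    InArcFrom h t p → InArcFrom h t r → Between m k r
InArcFrom-between {h} {t} {m} {k} ∉m ∉k (m<p , p<k) (inj₁ (h≤p , p≤t)) ∈r
  with h ≤? m | k ≤? t
... | yes h≤m | _ = ⊥-elim (∉m (inj₁ (h≤m , ≤-trans (<⇒≤ m<p) p≤t)))
... | no _ | yes k≤t = ⊥-elim (∉k (inj₁ (≤-trans h≤p (<⇒≤ p<k) , k≤t)))
... | no h≰m | no k≰t with ∈r
...   | inj₁ (h≤r , r≤t) = <-≤-trans (≰⇒> h≰m) h≤r , ≤-<-trans r≤t (≰⇒> k≰t)
...   | inj₂ (t<h , _) = ⊥-elim (<⇒≱ t<h (≤-trans h≤p p≤t))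
InArcFrom-between ∉m ∉k (m<p , p<k) (inj₂ (t<h , inj₁ h≤p)) _ =
  ⊥-elim (∉k (inj₂ (t<h , inj₁ (≤-trans h≤p (<⇒≤ p<k)))))
InArcFrom-between ∉m ∉k (m<p , p<k) (inj₂ (t<h , inj₂ p≤t)) _ =
  ⊥-elim (∉m (inj₂ (t<h , inj₂ (≤-trans (<⇒≤ m<p) p≤t))))

distinct-∈⇒2≤length : ∀ {A : Set} {xs : List A} {x y} → x ∈ xs → y ∈ xs → x ≢ y →
                      2 ≤ length xs
distinct-∈⇒2≤length (here refl) (here refl) x≢y = ⊥-elim (x≢y refl)
distinct-∈⇒2≤length (here _) (there y∈) _ = s≤s (∈-length y∈)
distinct-∈⇒2≤length (there x∈) (here _) _ = s≤s (∈-length x∈)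
distinct-∈⇒2≤length (there x∈) (there y∈) x≢y = m≤n⇒m≤1+n (distinct-∈⇒2≤length x∈ y∈ x≢y)

distinct-∈⇒3≤length : ∀ {A : Set} {xs : List A} {x y z} → x ∈ xs → y ∈ xs → z ∈ xs →
                      x ≢ y → x ≢ z → y ≢ z → 3 ≤ length xs
distinct-∈⇒3≤length (here refl) (here refl) _ x≢y _ _ = ⊥-elim (x≢y refl)
distinct-∈⇒3≤length (here refl) _ (here refl) _ x≢z _ = ⊥-elim (x≢z refl)
distinct-∈⇒3≤length _ (here refl) (here refl) _ _ y≢z = ⊥-elim (y≢z refl)
distinct-∈⇒3≤length (here _) (there y∈) (there z∈) _ _ y≢z = s≤s (distinct-∈⇒2≤length y∈ z∈ y≢z)
distinct-∈⇒3≤length (there x∈) (here _) (there z∈) _ x≢z _ = s≤s (distinct-∈⇒2≤length x∈ z∈ x≢z)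
distinct-∈⇒3≤length (there x∈) (there y∈) (here _) x≢y _ _ = s≤s (distinct-∈⇒2≤length x∈ y∈ x≢y)
distinct-∈⇒3≤length (there x∈) (there y∈) (there z∈) x≢y x≢z y≢z =
  m≤n⇒m≤1+n (distinct-∈⇒3≤length x∈ y∈ z∈ x≢y x≢z y≢z)

≤-linked-unique⇒<-linked : ∀ {xs} → Linked _≤_ xs → Unique xs → Linked _<_ xs
≤-linked-unique⇒<-linked [] _ = []
≤-linked-unique⇒<-linked [-] _ = [-]
≤-linked-unique⇒<-linked (x≤y ∷ linked) ((x≢y ∷ _) ∷ unique) =
  ≤∧≢⇒< x≤y x≢y ∷ ≤-linked-unique⇒<-linked linked unique

Ascending₄ : List ℕ → Set
Ascending₄ xs = ∃[ a ] ∃[ b ] ∃[ c ] ∃[ d ]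
  (Linked _<_ (a ∷ b ∷ c ∷ d ∷ []) × All (_∈ xs) (a ∷ b ∷ c ∷ d ∷ []))

<-linked⇒ascending₄ : ∀ xs → Linked _<_ xs → 4 ≤ length xs → Ascending₄ xs
<-linked⇒ascending₄ (a ∷ b ∷ c ∷ d ∷ _) (a<b ∷ b<c ∷ c<d ∷ _) _ =
  a , b , c , d , a<b ∷ b<c ∷ c<d ∷ [-] ,
  here refl ∷ there (here refl) ∷ there (there (here refl)) ∷
  there (there (there (here refl))) ∷ []
<-linked⇒ascending₄ [] _ ()
<-linked⇒ascending₄ (_ ∷ []) _ (s≤s ())
<-linked⇒ascending₄ (_ ∷ _ ∷ []) _ (s≤s (s≤s ()))
<-linked⇒ascending₄ (_ ∷ _ ∷ _ ∷ []) _ (s≤s (s≤s (s≤s ())))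

unique⇒ascending₄ : ∀ xs → Unique xs → 4 ≤ length xs → Ascending₄ xs
unique⇒ascending₄ xs unique 4≤length =
  fromSorted (<-linked⇒ascending₄ (sort xs) (≤-linked-unique⇒<-linked (sort-↗ xs) sorted-unique)
                (subst (4 ≤_) (sym (↭-length (sort-↭ xs))) 4≤length))
  where
  sorted-unique : Unique (sort xs)
  sorted-unique = Unique-resp-↭ (setoid ℕ) (↭⇒↭ₛ (↭-sym (sort-↭ xs))) unique
  fromSorted : Ascending₄ (sort xs) → Ascending₄ xs
  fromSorted (a , b , c , d , ascending , members) =
    a , b , c , d , ascending , All.map (∈-resp-↭ (sort-↭ xs)) members

Independent : (Fin n → Fin n → Set) → (Fin n → Set) → Set
Independent E X = ∀ x y → X x → X y → ¬ E x y

module _ {E T : Fin n → Fin n → Set} (lcst : IsLocallyConnectedSpanningTree E T) where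
  open IsLocallyConnectedSpanningTree lcst
  open IsSpanningTree spanningTree renaming (sym to T-sym)

  -- A tree path passes an independent set X only through some z ∈ X; the
  -- invariant carried along it is "outside X in S, or in X with a tree
  -- neighbour outside X in S", restored by a G-path in the neighbourhood of z.
  independent-nonSeparating :
    {X S : Fin n → Set} → Decidable X → Independent E X →
    (∀ {u w} → ¬ X u → ¬ X w → E u w → S u → S w) →
    ∀ {a b} → ¬ X a → ¬ X b → S a → S b
  independent-nonSeparating {X = X} {S} X? independent closed {a} {b} a∉X b∉X a∈S =
    leave (walk (connected a b) (inj₁ (a∉X , a∈S)))
    where
    Reached : Fin n → Set
    Reached z = (¬ X z × S z) ⊎ (X z × ∃[ w ] (T z w × ¬ X w × S w))

    T-neighbour∉X : ∀ {z v} → X z → T z v → ¬ X v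
    T-neighbour∉X z∈X Tzv v∈X = independent _ _ z∈X v∈X (subgraph _ _ Tzv)

    around : ∀ {z u w} → X z → Star (λ a b → E a b × T z a × T z b) u w →
             ¬ X u × S u → ¬ X w × S w
    around z∈X ε outside = outside
    around z∈X ((Euv , _ , Tzv) ◅ path) (u∉X , u∈S) =
      around z∈X path (T-neighbour∉X z∈X Tzv , closed u∉X (T-neighbour∉X z∈X Tzv) Euv u∈S)

    step : ∀ {z z'} → Reached z → T z z' → Reached z'
    step {z} {z'} (inj₁ (z∉X , z∈S)) Tzz' with X? z'
    ... | yes z'∈X = inj₂ (z'∈X , z , T-sym z z' Tzz' , z∉X , z∈S)
    ... | no z'∉X = inj₁ (z'∉X , closed z∉X z'∉X (subgraph z z' Tzz') z∈S)
    step {z} {z'} (inj₂ (z∈X , w , Tzw , w∉X , w∈S)) Tzz' =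
      inj₁ (around z∈X (locallyConnected z w z' Tzw Tzz') (w∉X , w∈S))

    walk : ∀ {u w} → Star T u w → Reached u → Reached w
    walk ε reached = reached
    walk (Tuv ◅ path) reached = walk path (step reached Tuv)

    leave : Reached b → S b
    leave (inj₁ (_ , b∈S)) = b∈S
    leave (inj₂ (b∈X , _)) = ⊥-elim (b∉X b∈X)

module _ (F : CAModel n) where

  Low : Fin n → Set
  Low v = density F v ≤ 2

  lowArcs : List (Fin n)
  lowArcs = filter (λ v → density F v ≤? 2) (allFin n)

  hd-injective : ∀ {u v} → hd F u ≡ hd F v → u ≡ v
  hd-injective {u} {v} eq = inj₁-injective (distinct F (inj₁ u) (inj₁ v) eq)

  hd-<⇒≢ : ∀ {u v} → hd F u < hd F v → u ≢ v
  hd-<⇒≢ lt refl = <-irrefl refl lt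

  lowHeads-unique : Unique (map (hd F) lowArcs)
  lowHeads-unique =
    Unique.map⁺ hd-injective (Unique.filter⁺ (λ v → density F v ≤? 2) (Unique.allFin⁺ n))

  lowHead : ∀ {h} → h ∈ map (hd F) lowArcs → ∃[ v ] (Low v × h ≡ hd F v)
  lowHead h∈ with ∈-map⁻ (hd F) h∈
  ... | v , v∈ , h≡hv = v , proj₂ (∈-filter⁻ (λ v → density F v ≤? 2) {xs = allFin n} v∈) , h≡hv

  CoversHead : Fin n → Fin n → Set
  CoversHead u v = u ≢ v × InArc F (hd F v) u

  coversHead? : ∀ u v → Dec (CoversHead u v)
  coversHead? u v = ¬? (u ≟ v) ×-dec inArcFrom? (hd F u) (tl F u) (hd F v)

  -- In doubled coordinates, odd p is the point p and even (hd F v) is a point just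
  -- before the head of v: no endpoint, lying on the arcs that cover hd F v other
  -- than v itself.
  InDoubledArc : Fin n → ℕ → Set
  InDoubledArc u = InArcFrom (odd (hd F u)) (odd (tl F u))

  coversHead⇒inDoubledArc : ∀ {u v} → CoversHead u v → InDoubledArc u (even (hd F v))
  coversHead⇒inDoubledArc (u≢v , inj₁ (h≤p , p≤t)) =
    inj₁ (<⇒≤ (odd<even (≤∧≢⇒< h≤p (u≢v ∘′ hd-injective))) , <⇒≤ (even<odd p≤t))
  coversHead⇒inDoubledArc (u≢v , inj₂ (t<h , inj₁ h≤p)) =
    inj₂ (odd-mono-< t<h , inj₁ (<⇒≤ (odd<even (≤∧≢⇒< h≤p (u≢v ∘′ hd-injective)))))
  coversHead⇒inDoubledArc (_ , inj₂ (t<h , inj₂ p≤t)) =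
    inj₂ (odd-mono-< t<h , inj₂ (<⇒≤ (even<odd p≤t)))

  inDoubledArc⇒coversHead : ∀ {u v} → InDoubledArc u (even (hd F v)) → CoversHead u v
  inDoubledArc⇒coversHead (inj₁ (h≤p , p≤t)) =
    hd-<⇒≢ (odd≤even⇒< h≤p) , inj₁ (<⇒≤ (odd≤even⇒< h≤p) , even≤odd⇒≤ p≤t)
  inDoubledArc⇒coversHead (inj₂ (t<h , inj₁ h≤p)) =
    hd-<⇒≢ (odd≤even⇒< h≤p) , inj₂ (odd-cancel-< t<h , inj₁ (<⇒≤ (odd≤even⇒< h≤p)))
  inDoubledArc⇒coversHead {u} {v} (inj₂ (t<h , inj₂ p≤t)) =
    (λ { refl → <⇒≱ tu<hu hv≤tu }) , inj₂ (tu<hu , inj₂ hv≤tu)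
    where
    tu<hu : tl F u < hd F u
    tu<hu = odd-cancel-< t<h
    hv≤tu : hd F v ≤ tl F u
    hv≤tu = even≤odd⇒≤ p≤t

  coversHead-upward : ∀ {u v w} → CoversHead w u → hd F u < hd F w → hd F w < hd F v →
                      CoversHead w v
  coversHead-upward (_ , ∈hu) hu<hw hw<hv =
    hd-<⇒≢ hw<hv , inj₂ (proj₁ (InArcFrom-below-head ∈hu hu<hw) , inj₁ (<⇒≤ hw<hv))

  coversHead-downward : ∀ {u v w} → CoversHead w v → hd F v < hd F w → hd F u ≤ hd F v →
                        CoversHead w u
  coversHead-downward (_ , ∈hv) hv<hw hu≤hv with InArcFrom-below-head ∈hv hv<hw
  ... | t<h , hv≤t =
    ≢-sym (hd-<⇒≢ (≤-<-trans hu≤hv hv<hw)) , inj₂ (t<h , inj₂ (≤-trans hu≤hv hv≤t))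

  low-uniqueCover : ∀ {v x y} → Low v → CoversHead x v → CoversHead y v → x ≡ y
  low-uniqueCover {v} {x} {y} low (x≢v , x∋hv) (y≢v , y∋hv) with x ≟ y
  ... | yes x≡y = x≡y
  ... | no x≢y = ⊥-elim (<⇒≱ (distinct-∈⇒3≤length (covering (InArcFrom-head _ _))
                        (covering x∋hv) (covering y∋hv) (≢-sym x≢v) (≢-sym y≢v) x≢y) low)
    where
    covering : ∀ {u} → InArc F (hd F v) u →
               u ∈ filter (λ u → inArcFrom? (hd F u) (tl F u) (hd F v)) (allFin n)
    covering u∋hv = ∈-filter⁺ (λ u → inArcFrom? (hd F u) (tl F u) (hd F v)) (∈-allFin _) u∋hv

  Adj-sym : ∀ {u w} → Adj F u w → Adj F w u
  Adj-sym (u≢w , p , u∋p , w∋p) = ≢-sym u≢w , p , w∋p , u∋p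

  low-covers-nonadjacent : ∀ {v x y} → Low v → CoversHead x v → CoversHead y v → ¬ Adj F x y
  low-covers-nonadjacent low cx cy (x≢y , _) = x≢y (low-uniqueCover low cx cy)

  CoversEither : Fin n → Fin n → Fin n → Set
  CoversEither vᵢ vⱼ u = CoversHead u vᵢ ⊎ CoversHead u vⱼ

  HeadBetween : Fin n → Fin n → Fin n → Set
  HeadBetween vᵢ vⱼ u = hd F vᵢ ≤ hd F u × hd F u < hd F vⱼ

  headBetween-closed : ∀ {vᵢ vⱼ u w} → ¬ CoversEither vᵢ vⱼ u → ¬ CoversEither vᵢ vⱼ w →
                       Adj F u w → HeadBetween vᵢ vⱼ u → HeadBetween vᵢ vⱼ w
  headBetween-closed {vᵢ} {vⱼ} {u} {w} u∉X w∉X (_ , p , u∋p , w∋p) (hᵢ≤hu , hu<hⱼ) =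
    even≤odd⇒≤ (<⇒≤ (proj₁ w-between)) , odd≤even⇒< (<⇒≤ (proj₂ w-between))
    where
    avoidsᵢ : ∀ {z} → ¬ CoversEither vᵢ vⱼ z → ¬ InDoubledArc z (even (hd F vᵢ))
    avoidsᵢ z∉X = z∉X ∘′ inj₁ ∘′ inDoubledArc⇒coversHead
    avoidsⱼ : ∀ {z} → ¬ CoversEither vᵢ vⱼ z → ¬ InDoubledArc z (even (hd F vⱼ))
    avoidsⱼ z∉X = z∉X ∘′ inj₂ ∘′ inDoubledArc⇒coversHead
    p-between : Between (even (hd F vᵢ)) (even (hd F vⱼ)) (odd p)
    p-between = InArcFrom-between (avoidsᵢ u∉X) (avoidsⱼ u∉X) (even<odd hᵢ≤hu , odd<even hu<hⱼ)
                  (InArcFrom-head _ _) (InArcFrom-odd u∋p)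
    w-between : Between (even (hd F vᵢ)) (even (hd F vⱼ)) (odd (hd F w))
    w-between = InArcFrom-between (avoidsᵢ w∉X) (avoidsⱼ w∉X) p-between
                  (InArcFrom-odd w∋p) (InArcFrom-head _ _)

  uncovered-between : ∀ {v₁ v₂ v₃} → Low v₃ → hd F v₁ < hd F v₂ → hd F v₂ < hd F v₃ →
                      ∃[ a ] (¬ CoversEither v₁ v₃ a × HeadBetween v₁ v₃ a)
  uncovered-between {v₁} {v₂} {v₃} l₃ h₁₂ h₂₃ with coversHead? v₁ v₃
  ... | no ¬c₁₃ = v₁ , v₁∉X , ≤-refl , <-trans h₁₂ h₂₃
    where
    v₁∉X : ¬ CoversEither v₁ v₃ v₁
    v₁∉X (inj₁ (v₁≢v₁ , _)) = v₁≢v₁ refl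
    v₁∉X (inj₂ c₁₃) = ¬c₁₃ c₁₃
  ... | yes c₁₃ = v₂ , v₂∉X , <⇒≤ h₁₂ , h₂₃
    where
    v₂∉X : ¬ CoversEither v₁ v₃ v₂
    v₂∉X (inj₁ c₂₁) = hd-<⇒≢ h₁₂ (low-uniqueCover l₃ c₁₃ (coversHead-upward c₂₁ h₁₂ h₂₃))
    v₂∉X (inj₂ c₂₃) = hd-<⇒≢ h₁₂ (low-uniqueCover l₃ c₁₃ c₂₃)

  uncovered-outside : ∀ {v₁ v₃ v₄} → Low v₁ → hd F v₁ < hd F v₃ → hd F v₃ < hd F v₄ →
                      ∃[ b ] (¬ CoversEither v₁ v₃ b × ¬ HeadBetween v₁ v₃ b)
  uncovered-outside {v₁} {v₃} {v₄} l₁ h₁₃ h₃₄ with coversHead? v₃ v₁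
  ... | no ¬c₃₁ = v₃ , v₃∉X , λ (_ , h₃<h₃) → <-irrefl refl h₃<h₃
    where
    v₃∉X : ¬ CoversEither v₁ v₃ v₃
    v₃∉X (inj₁ c₃₁) = ¬c₃₁ c₃₁
    v₃∉X (inj₂ (v₃≢v₃ , _)) = v₃≢v₃ refl
  ... | yes c₃₁ = v₄ , v₄∉X , λ (_ , h₄<h₃) → <-asym h₄<h₃ h₃₄
    where
    v₄∉X : ¬ CoversEither v₁ v₃ v₄
    v₄∉X (inj₁ c₄₁) = hd-<⇒≢ h₃₄ (low-uniqueCover l₁ c₃₁ c₄₁)
    v₄∉X (inj₂ c₄₃) = hd-<⇒≢ h₃₄ (low-uniqueCover l₁ c₃₁ (coversHead-downward c₄₃ h₃₄ (<⇒≤ h₁₃)))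

  module _ {T : Fin n → Fin n → Set} (lcst : IsLocallyConnectedSpanningTree (Adj F) T) where

    headBetween-preserved : ∀ {vᵢ vⱼ a b} → Independent (Adj F) (CoversEither vᵢ vⱼ) →
                            ¬ CoversEither vᵢ vⱼ a → ¬ CoversEither vᵢ vⱼ b →
                            HeadBetween vᵢ vⱼ a → HeadBetween vᵢ vⱼ b
    headBetween-preserved {vᵢ} {vⱼ} independent =
      independent-nonSeparating lcst (λ u → coversHead? u vᵢ ⊎-dec coversHead? u vⱼ)
        independent headBetween-closed

    no-common-cover-< : ∀ {vᵢ vⱼ x} → Low vᵢ → Low vⱼ → hd F vᵢ < hd F vⱼ →
                        CoversHead x vᵢ → CoversHead x vⱼ → ⊥
    no-common-cover-< {vᵢ} {vⱼ} {x} lᵢ lⱼ hᵢⱼ cᵢ cⱼ =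
      <-irrefl refl (proj₂ (headBetween-preserved independent vᵢ∉X vⱼ∉X (≤-refl , hᵢⱼ)))
      where
      is-x : ∀ {z} → CoversEither vᵢ vⱼ z → z ≡ x
      is-x (inj₁ c) = low-uniqueCover lᵢ c cᵢ
      is-x (inj₂ c) = low-uniqueCover lⱼ c cⱼ
      independent : Independent (Adj F) (CoversEither vᵢ vⱼ)
      independent y z y∈X z∈X (y≢z , _) = y≢z (trans (is-x y∈X) (sym (is-x z∈X)))
      vᵢ∉X : ¬ CoversEither vᵢ vⱼ vᵢ
      vᵢ∉X (inj₁ (vᵢ≢vᵢ , _)) = vᵢ≢vᵢ refl
      vᵢ∉X (inj₂ c) = proj₁ cᵢ (sym (low-uniqueCover lⱼ c cⱼ))
      vⱼ∉X : ¬ CoversEither vᵢ vⱼ vⱼ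
      vⱼ∉X (inj₁ c) = proj₁ cⱼ (sym (low-uniqueCover lᵢ c cᵢ))
      vⱼ∉X (inj₂ (vⱼ≢vⱼ , _)) = vⱼ≢vⱼ refl

    no-common-cover : ∀ {u v x} → Low u → Low v → u ≢ v → CoversHead x u → CoversHead x v → ⊥
    no-common-cover {u} {v} lu lv u≢v cu cv with <-cmp (hd F u) (hd F v)
    ... | tri< hu<hv _ _ = no-common-cover-< lu lv hu<hv cu cv
    ... | tri≈ _ hu≡hv _ = u≢v (hd-injective hu≡hv)
    ... | tri> _ _ hv<hu = no-common-cover-< lv lu hv<hu cv cu

    module _ {v₁ v₂ v₃ v₄ : Fin n} (l₁ : Low v₁) (l₂ : Low v₂) (l₃ : Low v₃) (l₄ : Low v₄)
             (h₁₂ : hd F v₁ < hd F v₂) (h₂₃ : hd F v₂ < hd F v₃) (h₃₄ : hd F v₃ < hd F v₄) where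

      -- Covers of h(v₁) and of h(v₃) avoid the points just before h(v₂) and h(v₄),
      -- and lie on different sides of them.
      cross-covers-nonadjacent : ∀ {x y} → CoversHead x v₁ → CoversHead y v₃ → ¬ Adj F x y
      cross-covers-nonadjacent cx cy (_ , p , x∋p , y∋p) =
        <-asym (even-mono-< h₁₂) (proj₁ h₁-between)
        where
        avoids : ∀ {u v z} → Low u → Low v → u ≢ v → CoversHead z u →
                 ¬ InDoubledArc z (even (hd F v))
        avoids lu lv u≢v cz = no-common-cover lu lv u≢v cz ∘′ inDoubledArc⇒coversHead
        p-between : Between (even (hd F v₂)) (even (hd F v₄)) (odd p)
        p-between =
          InArcFrom-between (avoids l₃ l₂ (≢-sym (hd-<⇒≢ h₂₃)) cy) (avoids l₃ l₄ (hd-<⇒≢ h₃₄) cy)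
            (even-mono-< h₂₃ , even-mono-< h₃₄) (coversHead⇒inDoubledArc cy) (InArcFrom-odd y∋p)
        h₁-between : Between (even (hd F v₂)) (even (hd F v₄)) (even (hd F v₁))
        h₁-between =
          InArcFrom-between (avoids l₁ l₂ (hd-<⇒≢ h₁₂) cx)
            (avoids l₁ l₄ (hd-<⇒≢ (<-trans h₁₂ (<-trans h₂₃ h₃₄))) cx)
            p-between (InArcFrom-odd x∋p) (coversHead⇒inDoubledArc cx)

      coversEither-independent : Independent (Adj F) (CoversEither v₁ v₃)
      coversEither-independent _ _ (inj₁ cx) (inj₁ cy) = low-covers-nonadjacent l₁ cx cy
      coversEither-independent _ _ (inj₂ cx) (inj₂ cy) = low-covers-nonadjacent l₃ cx cy
      coversEither-independent _ _ (inj₁ cx) (inj₂ cy) = cross-covers-nonadjacent cx cy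
      coversEither-independent _ _ (inj₂ cx) (inj₁ cy) = cross-covers-nonadjacent cy cx ∘′ Adj-sym

      no-four-lowArcs : ⊥
      no-four-lowArcs
        with uncovered-between l₃ h₁₂ h₂₃ | uncovered-outside l₁ (<-trans h₁₂ h₂₃) h₃₄
      ... | _ , a∉X , a∈S | _ , b∉X , b∉S =
        b∉S (headBetween-preserved coversEither-independent a∉X b∉X a∈S)

lemma4 : (n : ℕ) (F : CAModel n) → 4 ≤ numLowDensity F →
    ¬ Σ (Fin n → Fin n → Set) (λ T → IsLocallyConnectedSpanningTree (Adj F) T)
lemma4 n F four (_ , lcst)
  with unique⇒ascending₄ (map (hd F) (lowArcs F)) (lowHeads-unique F)
         (subst (4 ≤_) (sym (length-map (hd F) (lowArcs F))) four)
... | _ , _ , _ , _ , h₁₂ ∷ h₂₃ ∷ h₃₄ ∷ [-] , m₁ ∷ m₂ ∷ m₃ ∷ m₄ ∷ []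
  with lowHead F m₁ | lowHead F m₂ | lowHead F m₃ | lowHead F m₄
... | _ , l₁ , refl | _ , l₂ , refl | _ , l₃ , refl | _ , l₄ , refl =
  no-four-lowArcs F lcst l₁ l₂ l₃ l₄ h₁₂ h₂₃ h₃₄
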